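{- Let $p\geq 4$ be an integer and let $t=\binom{p-1}{2}$. There exists a finite graph $G$ such that $\chi_{rlid}(G)=p$ and $\chi_{rlid}(G)=\chi_{rlid}(G/\mathcal{R})-t$.
   Context: For a vertex $x$, $N[x]$ is its closed neighborhood. Distinct vertices $u,v$ are twins if $N[u]=N[v]$; $G/\mathcal{R}$ (the maximal twin-free subgraph of $G$) is the induced subgraph of $G$ obtained by keeping exactly one vertex from each class of the equivalence relation $N[u]=N[v]$. An $rlid$-coloring of a graph $H$ is a map $c:V(H)\to\mathbb{N}$ (not necessarily proper) such that for every pair of adjacent vertices $u,v$ with $N[u]\neq N[v]$ we have $c(N[u])\neq c(N[v])$, where $c(X)=\{c(x):x\in X\}$; $\chi_{rlid}(H)$ is the minimum number of colors in an $rlid$-coloring of $H$. -}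

module Defs where

open import Data.Nat using (ℕ; _≤_)
open import Data.Fin using (Fin)
open import Data.Bool using (Bool; true; false)
open import Data.Product using (Σ; ∃; ∃-syntax; _×_)
open import Data.Sum using (_⊎_)
open import Relation.Nullary using (¬_)
open import Relation.Binary.PropositionalEquality using (_≡_)

record Graph (n : ℕ) : Set where
  field
    adj   : Fin n → Fin n → Bool
    sym   : ∀ x y → adj x y ≡ adj y x
    loopless : ∀ x → adj x x ≡ false
open Graph public

module _ {n : ℕ} (G : Graph n) where

  InN : Fin n → Fin n → Set
  InN x y = (y ≡ x) ⊎ (adj G x y ≡ true)

  Adjacent : Fin n → Fin n → Set
  Adjacent u v = adj G u v ≡ true

  SameN : Fin n → Fin n → Set
  SameN u v = ∀ w → (InN u w → InN v w) × (InN v w → InN u w)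

  InColN : (c : Fin n → ℕ) → Fin n → ℕ → Set
  InColN c x k = ∃[ w ] (InN x w × c w ≡ k)

  SameColN : (c : Fin n → ℕ) → Fin n → Fin n → Set
  SameColN c u v = ∀ k → (InColN c u k → InColN c v k) × (InColN c v k → InColN c u k)

  -- rlid-colouring (not necessarily proper)
  IsRlid : (Fin n → ℕ) → Set
  IsRlid c = ∀ u v → Adjacent u v → ¬ SameN u v → ¬ SameColN c u v

  HasRlidColouring : ℕ → Set
  HasRlidColouring k = Σ (Fin n → Fin k) λ c → IsRlid (λ x → Data.Fin.toℕ (c x))

  ChiRlid≡ : ℕ → Set
  ChiRlid≡ k = HasRlidColouring k × (∀ j → HasRlidColouring j → k ≤ j)

  IsTwinRepresentatives : {m : ℕ} → (Fin m → Fin n) → Set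
  IsTwinRepresentatives {m} f =
    (∀ i j → SameN (f i) (f j) → i ≡ j) × (∀ x → ∃[ i ] SameN x (f i))

induced : {n m : ℕ} → Graph n → (Fin m → Fin n) → Graph m
induced G f = record
  { adj = λ i j → adj G (f i) (f j)
  ; sym = λ i j → sym G (f i) (f j)
  ; loopless = λ i → loopless G (f i) }

-- Let H be the complete digraph on a set X with every arc i → j replaced by a path
-- x i — u i j — v i j — x j.  H is twin-free, and in every rlid-colouring the closed
-- neighbourhoods of u i j and v i j, which differ only in x i versus x j, force the
-- fibres over x i and x j to carry different colour sets.  With X = Fin p ⊎ Fin t and
-- t = C(p-1, 2), blow up each x (inj₂ k) into two true twins and give the pair the k-th
-- 2-subset of the first p-1 colours.  The p singleton classes force p colours, and p
-- colours suffice because distinct twin classes carry distinct colour sets.  The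
-- twin-free quotient is H itself, whose x-vertices all need distinct colours, so its
-- rlid-chromatic number is |X| = p + t.
module Submission where

open import Defs hiding (sym)
open import Data.Bool using (true)
open import Data.Empty using (⊥; ⊥-elim)
open import Data.Fin using (Fin; zero; suc; toℕ; inject₁; fromℕ; splitAt; join; _<_)
open import Data.Fin.Properties
  using (_≟_; any?; ¬∀⟶∃¬; injective⇒≤; <⇒≢; <-irrefl; <-asym; toℕ<n; toℕ-inject₁;
         toℕ-fromℕ; toℕ-inject₁-≢; inject₁-injective; toℕ-injective;
         join-splitAt; +↔⊎; *↔×)
open import Data.Nat using (ℕ; zero; suc; _+_; _*_; _≤_; _∸_; s≤s; z≤n)
import Data.Nat as ℕ
open import Data.Nat.Properties using (<⇒≱; m+n∸n≡m)
open import Data.Nat.Combinatorics using (_C_; nC1≡n; nCk+nC[k+1]≡[n+1]C[k+1])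
open import Data.Product using (Σ; ∃; ∃-syntax; _×_; _,_; proj₁; proj₂; map₂; swap)
import Data.Product as Product
open import Data.Product.Properties using (,-injective) renaming (≡-dec to ×-≡-dec)
open import Data.Product.Function.NonDependent.Propositional using (_×-↔_)
open import Data.Sum using (_⊎_; inj₁; inj₂; [_,_]′; map₁)
open import Data.Sum.Properties using (inj₁-injective) renaming (≡-dec to ⊎-≡-dec)
open import Data.Sum.Function.Propositional using (_⊎-↔_)
open import Data.Vec.Functional using (Vector; []; _∷_)
open import Function using (_∘_; id; _↔_; Inverse; Injection; mk⇔)
open import Function.Definitions using (Injective)
open import Function.Properties.Inverse using (↔-refl; ↔-sym; ↔-trans; ↔⇒↣)
open import Relation.Binary.Definitions using (DecidableEquality; Decidable)
open import Relation.Binary.PropositionalEquality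
  using (_≡_; _≢_; refl; sym; trans; cong; cong₂; subst; subst₂)
open import Relation.Nullary using (¬_; Dec; yes; no; does)
open import Relation.Nullary.Decidable
  using (¬?; _×-dec_; _⊎-dec_; map′; dec-true; dec-false; does-⇔)

<⇒∃-avoided : ∀ {k n} → k ℕ.< n → (f : Vector (Fin n) k) → ∃[ c ] ∀ i → f i ≢ c
<⇒∃-avoided {k} {n} k<n f =
  map₂ (λ c∉ i fi≡c → c∉ (i , fi≡c))
    (¬∀⟶∃¬ n (λ c → ∃[ i ] f i ≡ c) (λ c → any? (λ i → f i ≟ c)) notSurjective)
  where
  notSurjective : ¬ (∀ c → ∃[ i ] f i ≡ c)
  notSurjective hit = <⇒≱ k<n (injective⇒≤ {f = proj₁ ∘ hit} λ {c} {c′} e →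
    trans (sym (proj₂ (hit c))) (trans (cong f e) (proj₂ (hit c′))))

does≡true⇒ : ∀ {A : Set} (a? : Dec A) → does a? ≡ true → A
does≡true⇒ (yes a) _ = a

sorted-pair-⊆ : ∀ {n} {a b c d : Fin n} → a < b → c < d →
                a ≡ c ⊎ a ≡ d → b ≡ c ⊎ b ≡ d → a ≡ c × b ≡ d
sorted-pair-⊆ a<b c<d (inj₁ refl) (inj₁ refl) = ⊥-elim (<-irrefl refl a<b)
sorted-pair-⊆ a<b c<d (inj₁ refl) (inj₂ refl) = refl , refl
sorted-pair-⊆ a<b c<d (inj₂ refl) (inj₁ refl) = ⊥-elim (<-asym a<b c<d)
sorted-pair-⊆ a<b c<d (inj₂ refl) (inj₂ refl) = ⊥-elim (<-irrefl refl a<b)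

choose2 : ℕ → ℕ
choose2 zero    = 0
choose2 (suc q) = q + choose2 q

choose2≡C : ∀ q → choose2 q ≡ q C 2
choose2≡C zero    = refl
choose2≡C (suc q) =
  trans (cong₂ _+_ (sym (nC1≡n q)) (choose2≡C q)) (nCk+nC[k+1]≡[n+1]C[k+1] q 1)

mutual
  sortedPair : ∀ q → Fin (choose2 q) → Fin q × Fin q
  sortedPair (suc q) k = extendPair q (splitAt q k)

  extendPair : ∀ q → Fin q ⊎ Fin (choose2 q) → Fin (suc q) × Fin (suc q)
  extendPair q (inj₁ a) = inject₁ a , fromℕ q
  extendPair q (inj₂ k) = Product.map inject₁ inject₁ (sortedPair q k)

mutual
  sortedPair-< : ∀ q k → proj₁ (sortedPair q k) < proj₂ (sortedPair q k)
  sortedPair-< (suc q) k = extendPair-< q (splitAt q k)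

  extendPair-< : ∀ q s → proj₁ (extendPair q s) < proj₂ (extendPair q s)
  extendPair-< q (inj₁ a) rewrite toℕ-inject₁ a | toℕ-fromℕ q = toℕ<n a
  extendPair-< q (inj₂ k)
    rewrite toℕ-inject₁ (proj₁ (sortedPair q k)) | toℕ-inject₁ (proj₂ (sortedPair q k)) =
    sortedPair-< q k

mutual
  sortedPair-injective : ∀ q → Injective _≡_ _≡_ (sortedPair q)
  sortedPair-injective (suc q) {k} {k′} e =
    trans (sym (join-splitAt q _ k))
      (trans (cong (join q _) (extendPair-injective q e)) (join-splitAt q _ k′))

  extendPair-injective : ∀ q → Injective _≡_ _≡_ (extendPair q)
  extendPair-injective q {inj₁ a} {inj₁ b} e = cong inj₁ (inject₁-injective (proj₁ (,-injective e)))
  extendPair-injective q {inj₁ a} {inj₂ k} e =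
    ⊥-elim (toℕ-inject₁-≢ _ (trans (sym (toℕ-fromℕ q)) (cong toℕ (proj₂ (,-injective e)))))
  extendPair-injective q {inj₂ k} {inj₁ a} e =
    ⊥-elim (toℕ-inject₁-≢ _ (trans (sym (toℕ-fromℕ q)) (cong toℕ (sym (proj₂ (,-injective e))))))
  extendPair-injective q {inj₂ k} {inj₂ k′} e with ,-injective e
  ... | e₁ , e₂ =
    cong inj₂ (sortedPair-injective q (cong₂ _,_ (inject₁-injective e₁) (inject₁-injective e₂)))

-- u i i and v i i are isolated vertices: they are not twins, so they do no harm.
module ArcSubdivision {X : Set} (_≟X_ : DecidableEquality X) where

  Vertex : Set
  Vertex = X ⊎ (X × X) ⊎ (X × X)

  pattern x i   = inj₁ i
  pattern u i j = inj₂ (inj₁ (i , j))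
  pattern v i j = inj₂ (inj₂ (i , j))

  private variable
    i j : X
    h h′ : Vertex

  _≟V_ : DecidableEquality Vertex
  _≟V_ = ⊎-≡-dec _≟X_ (⊎-≡-dec (×-≡-dec _≟X_ _≟X_) (×-≡-dec _≟X_ _≟X_))

  data Edge : Vertex → Vertex → Set where
    xu : i ≢ j → Edge (x i) (u i j)
    uv : i ≢ j → Edge (u i j) (v i j)
    vx : i ≢ j → Edge (v i j) (x j)

  edge? : Decidable Edge
  edge? (x a) (u i j) =
    map′ (λ { (refl , i≢j) → xu i≢j }) (λ { (xu i≢j) → refl , i≢j }) (a ≟X i ×-dec ¬? (i ≟X j))
  edge? (u i j) (v k l) =
    map′ (λ { ((refl , refl) , i≢j) → uv i≢j }) (λ { (uv i≢j) → (refl , refl) , i≢j })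
         ((i ≟X k ×-dec j ≟X l) ×-dec ¬? (i ≟X j))
  edge? (v i j) (x a) =
    map′ (λ { (refl , i≢j) → vx i≢j }) (λ { (vx i≢j) → refl , i≢j }) (j ≟X a ×-dec ¬? (i ≟X j))
  edge? (x _)   (x _)   = no λ ()
  edge? (x _)   (v _ _) = no λ ()
  edge? (u _ _) (x _)   = no λ ()
  edge? (u _ _) (u _ _) = no λ ()
  edge? (v _ _) (u _ _) = no λ ()
  edge? (v _ _) (v _ _) = no λ ()

  Near : Vertex → Vertex → Set
  Near h h′ = h′ ≡ h ⊎ Edge h h′ ⊎ Edge h′ h

  near? : Decidable Near
  near? h h′ = h′ ≟V h ⊎-dec edge? h h′ ⊎-dec edge? h′ h

  near-refl : Near h h
  near-refl = inj₁ refl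

  near-sym : Near h h′ → Near h′ h
  near-sym (inj₁ refl)     = inj₁ refl
  near-sym (inj₂ (inj₁ e)) = inj₂ (inj₂ e)
  near-sym (inj₂ (inj₂ e)) = inj₂ (inj₁ e)

  near-u : Near (u i j) h → h ≡ u i j ⊎ h ≡ v i j ⊎ h ≡ x i
  near-u (inj₁ refl)           = inj₁ refl
  near-u (inj₂ (inj₁ (uv _))) = inj₂ (inj₁ refl)
  near-u (inj₂ (inj₂ (xu _))) = inj₂ (inj₂ refl)

  near-v : Near (v i j) h → h ≡ v i j ⊎ h ≡ u i j ⊎ h ≡ x j
  near-v (inj₁ refl)           = inj₁ refl
  near-v (inj₂ (inj₁ (vx _))) = inj₂ (inj₂ refl)
  near-v (inj₂ (inj₂ (uv _))) = inj₂ (inj₁ refl)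

  edge-distinguishes : Edge h h′ → (∃[ w ] Near h w × ¬ Near h′ w) ⊎ (∃[ w ] Near h′ w × ¬ Near h w)
  edge-distinguishes (xu i≢j) = inj₂ (_ , inj₂ (inj₁ (uv i≢j)) ,
    λ { (inj₁ ()) ; (inj₂ (inj₁ ())) ; (inj₂ (inj₂ (vx _))) → i≢j refl })
  edge-distinguishes (uv i≢j) = inj₁ (_ , inj₂ (inj₂ (xu i≢j)) ,
    λ { (inj₁ ()) ; (inj₂ (inj₁ (vx _))) → i≢j refl ; (inj₂ (inj₂ ())) })
  edge-distinguishes (vx i≢j) = inj₁ (_ , inj₂ (inj₂ (uv i≢j)) ,
    λ { (inj₁ ()) ; (inj₂ (inj₁ (xu _))) → i≢j refl ; (inj₂ (inj₂ ())) })

  edge-notTwins : Edge h h′ → (∀ w → Near h w → Near h′ w) → (∀ w → Near h′ w → Near h w) → ⊥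
  edge-notTwins e to from with edge-distinguishes e
  ... | inj₁ (w , n , ¬n) = ¬n (to w n)
  ... | inj₂ (w , n , ¬n) = ¬n (from w n)

  twinFree : (∀ w → Near h w → Near h′ w) → (∀ w → Near h′ w → Near h w) → h ≡ h′
  twinFree {h} to from with to h near-refl
  ... | inj₁ h≡h′     = h≡h′
  ... | inj₂ (inj₁ e) = ⊥-elim (edge-notTwins e from to)
  ... | inj₂ (inj₂ e) = ⊥-elim (edge-notTwins e to from)

  module _ {C : Set} (P : Vertex → C → Set) where

    NearColours : Vertex → C → Set
    NearColours h a = ∃[ h′ ] Near h h′ × P h′ a

    Separates : Vertex → Vertex → Set
    Separates h h′ = ∃[ a ] NearColours h a × ¬ NearColours h′ a

    nearColours-u : ∀ {a} → NearColours (u i j) a → P (u i j) a ⊎ P (v i j) a ⊎ P (x i) a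
    nearColours-u (_ , n , p) with near-u n
    ... | inj₁ refl        = inj₁ p
    ... | inj₂ (inj₁ refl) = inj₂ (inj₁ p)
    ... | inj₂ (inj₂ refl) = inj₂ (inj₂ p)

    nearColours-v : ∀ {a} → NearColours (v i j) a → P (v i j) a ⊎ P (u i j) a ⊎ P (x j) a
    nearColours-v (_ , n , p) with near-v n
    ... | inj₁ refl        = inj₁ p
    ... | inj₂ (inj₁ refl) = inj₂ (inj₁ p)
    ... | inj₂ (inj₂ refl) = inj₂ (inj₂ p)

    nearColours-u⊆v : i ≢ j → (∀ a → P (x i) a → P (x j) a) →
                      ∀ a → NearColours (u i j) a → NearColours (v i j) a
    nearColours-u⊆v i≢j xi⊆xj a c with nearColours-u c
    ... | inj₁ p        = _ , inj₂ (inj₂ (uv i≢j)) , p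
    ... | inj₂ (inj₁ p) = _ , near-refl , p
    ... | inj₂ (inj₂ p) = _ , inj₂ (inj₁ (vx i≢j)) , xi⊆xj a p

    nearColours-v⊆u : i ≢ j → (∀ a → P (x j) a → P (x i) a) →
                      ∀ a → NearColours (v i j) a → NearColours (u i j) a
    nearColours-v⊆u i≢j xj⊆xi a c with nearColours-v c
    ... | inj₁ p        = _ , inj₂ (inj₁ (uv i≢j)) , p
    ... | inj₂ (inj₁ p) = _ , near-refl , p
    ... | inj₂ (inj₂ p) = _ , inj₂ (inj₂ (xu i≢j)) , xj⊆xi a p

  -- G arises from the pattern by replacing every vertex h with the fibre of proj over h,
  -- a nonempty clique of true twins.
  record BlowUp {n} (G : Graph n) : Set where
    field
      proj      : Fin n → Vertex
      lift      : Vertex → Fin n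
      proj-lift : ∀ h → proj (lift h) ≡ h
      inN⇒near  : ∀ {w z} → InN G w z → Near (proj w) (proj z)
      near⇒inN  : ∀ {w z} → Near (proj w) (proj z) → InN G w z

  record IsPalette {n k} {G : Graph n} (B : BlowUp G) (c : Fin n → Fin k)
                   (P : Vertex → Fin k → Set) : Set where
    open BlowUp B
    field
      sound    : ∀ z → P (proj z) (c z)
      complete : ∀ {h a} → P h a → ∃[ z ] proj z ≡ h × c z ≡ a

  module _ {n} {G : Graph n} (B : BlowUp G) where
    open BlowUp B

    proj≡⇒sameN : ∀ {w w′} → proj w ≡ proj w′ → SameN G w w′
    proj≡⇒sameN e z = (λ n → near⇒inN (subst (λ h → Near h (proj z)) e (inN⇒near n)))
                    , (λ n → near⇒inN (subst (λ h → Near h (proj z)) (sym e) (inN⇒near n)))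

    sameN⇒proj≡ : ∀ {w w′} → SameN G w w′ → proj w ≡ proj w′
    sameN⇒proj≡ {w} {w′} s = twinFree (λ h n → toLift (proj₁ (s (lift h)) (fromLift n)))
                                       (λ h n → toLift (proj₂ (s (lift h)) (fromLift n)))
      where
      fromLift : ∀ {w h} → Near (proj w) h → InN G w (lift h)
      fromLift {w} {h} n = near⇒inN (subst (Near (proj w)) (sym (proj-lift h)) n)
      toLift : ∀ {w h} → InN G w (lift h) → Near (proj w) h
      toLift {w} {h} n = subst (Near (proj w)) (proj-lift h) (inN⇒near n)

    lift-adjacent : h ≢ h′ → Near h h′ → Adjacent G (lift h) (lift h′)
    lift-adjacent {h} {h′} h≢h′ n
      with near⇒inN (subst₂ Near (sym (proj-lift h)) (sym (proj-lift h′)) n)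
    ... | inj₁ e =
      ⊥-elim (h≢h′ (trans (sym (proj-lift h)) (trans (cong proj (sym e)) (proj-lift h′))))
    ... | inj₂ a = a

    lift-notTwins : h ≢ h′ → ¬ SameN G (lift h) (lift h′)
    lift-notTwins {h} {h′} h≢h′ s =
      h≢h′ (trans (sym (proj-lift h)) (trans (sameN⇒proj≡ s) (proj-lift h′)))

    module _ {k} {c : Fin n → Fin k} {P : Vertex → Fin k → Set} (palette : IsPalette B c P) where
      open IsPalette palette

      nearColours⇒inColN : ∀ {w a} → NearColours P (proj w) a → InColN G (toℕ ∘ c) w (toℕ a)
      nearColours⇒inColN (_ , n , p) with complete p
      ... | z , refl , refl = z , near⇒inN n , refl

      inColN⇒nearColours : ∀ {w a} → InColN G (toℕ ∘ c) w (toℕ a) → NearColours P (proj w) a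
      inColN⇒nearColours (z , n , e) =
        proj z , inN⇒near n , subst (P (proj z)) (toℕ-injective e) (sound z)

      sameColN-from : ∀ {w w′} → proj w ≡ h → proj w′ ≡ h′ →
                      (∀ a → NearColours P h a → NearColours P h′ a) →
                      (∀ a → NearColours P h′ a → NearColours P h a) →
                      SameColN G (toℕ ∘ c) w w′
      sameColN-from refl refl to from m = transfer to m , transfer from m
        where
        transfer : ∀ {w w′} → (∀ a → NearColours P (proj w) a → NearColours P (proj w′) a) →
                   ∀ m → InColN G (toℕ ∘ c) w m → InColN G (toℕ ∘ c) w′ m
        transfer f m (z , n , refl) = nearColours⇒inColN (f (c z) (proj z , inN⇒near n , sound z))

      sameColN⇒¬separates : ∀ {w w′} → SameColN G (toℕ ∘ c) w w′ → ¬ Separates P (proj w) (proj w′)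
      sameColN⇒¬separates same (a , near , far) =
        far (inColN⇒nearColours (proj₁ (same (toℕ a)) (nearColours⇒inColN near)))

      isRlid-if-separated : (∀ {h h′} → Edge h h′ → Separates P h h′ ⊎ Separates P h′ h) →
                            IsRlid G (toℕ ∘ c)
      isRlid-if-separated separated w w′ adj notTwins same with inN⇒near (inj₂ adj)
      ... | inj₁ e        = notTwins (proj≡⇒sameN (sym e))
      ... | inj₂ (inj₁ e) = [ sameColN⇒¬separates same , sameColN⇒¬separates (swap ∘ same) ]′
                                (separated e)
      ... | inj₂ (inj₂ e) = [ sameColN⇒¬separates (swap ∘ same) , sameColN⇒¬separates same ]′
                                (separated e)

      xColours-apart : IsRlid G (toℕ ∘ c) → i ≢ j →
                       (∀ a → P (x i) a → P (x j) a) → (∀ a → P (x j) a → P (x i) a) → ⊥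
      xColours-apart rlid i≢j xi⊆xj xj⊆xi =
        rlid (lift (u _ _)) (lift (v _ _))
          (lift-adjacent (λ ()) (inj₂ (inj₁ (uv i≢j)))) (lift-notTwins (λ ()))
          (sameColN-from (proj-lift _) (proj-lift _)
            (nearColours-u⊆v P i≢j xi⊆xj) (nearColours-v⊆u P i≢j xj⊆xi))

    FibreColours : ∀ {k} → (Fin n → Fin k) → Vertex → Fin k → Set
    FibreColours c h a = ∃[ z ] proj z ≡ h × c z ≡ a

    fibreColours-isPalette : ∀ {k} (c : Fin n → Fin k) → IsPalette B c (FibreColours c)
    fibreColours-isPalette c = record { sound = λ z → z , refl , refl ; complete = id }

    rlid-lowerBound : ∀ {k} (ι : Fin k → X) → Injective _≡_ _≡_ ι →
                      (∀ a z → proj z ≡ x (ι a) → z ≡ lift (x (ι a))) →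
                      ∀ {j} → HasRlidColouring G j → k ≤ j
    rlid-lowerBound {k} ι ι-injective singleton (c , rlid) = injective⇒≤ colour-injective
      where
      representative : Fin k → Fin n
      representative a = lift (x (ι a))

      fibre⊆ : ∀ {a b} → c (representative a) ≡ c (representative b) →
               ∀ m → FibreColours c (x (ι a)) m → FibreColours c (x (ι b)) m
      fibre⊆ {a} e _ (z , pz , refl) =
        _ , proj-lift _ , trans (sym e) (cong c (sym (singleton a z pz)))

      colour-injective : Injective _≡_ _≡_ (c ∘ representative)
      colour-injective {a} {b} e with a ≟ b
      ... | yes a≡b = a≡b
      ... | no a≢b  = ⊥-elim (xColours-apart (fibreColours-isPalette c) rlid (a≢b ∘ ι-injective)
                                             (fibre⊆ e) (fibre⊆ (sym e)))

  module _ {n} (d : Fin n → Vertex) where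

    Linked : Fin n → Fin n → Set
    Linked w z = w ≢ z × Near (d w) (d z)

    linked? : Decidable Linked
    linked? w z = ¬? (w ≟ z) ×-dec near? (d w) (d z)

    linked-sym : ∀ {w z} → Linked w z → Linked z w
    linked-sym (w≢z , n) = w≢z ∘ sym , near-sym n

    blowUp : Graph n
    blowUp = record
      { adj      = λ w z → does (linked? w z)
      ; sym      = λ w z → does-⇔ (mk⇔ linked-sym linked-sym) (linked? w z) (linked? z w)
      ; loopless = λ w → dec-false (linked? w w) (λ (w≢w , _) → w≢w refl)
      }

    blowUp-isBlowUp : (s : Vertex → Fin n) → (∀ h → d (s h) ≡ h) → BlowUp blowUp
    blowUp-isBlowUp s d∘s = record
      { proj      = d
      ; lift      = s
      ; proj-lift = d∘s
      ; inN⇒near  = inN⇒near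
      ; near⇒inN  = near⇒inN
      }
      where
      inN⇒near : ∀ {w z} → InN blowUp w z → Near (d w) (d z)
      inN⇒near         (inj₁ refl) = near-refl
      inN⇒near {w} {z} (inj₂ e)    = proj₂ (does≡true⇒ (linked? w z) e)

      near⇒inN : ∀ {w z} → Near (d w) (d z) → InN blowUp w z
      near⇒inN {w} {z} n with z ≟ w
      ... | yes z≡w = inj₁ z≡w
      ... | no z≢w  = inj₂ (dec-true (linked? w z) (z≢w ∘ sym , n))

  module _ {n} {G : Graph n} (B : BlowUp G) {m} {f : Fin m → Fin n}
           (reps : IsTwinRepresentatives G f) where
    private module B = BlowUp B

    twinQuotient : BlowUp (induced G f)
    twinQuotient = record
      { proj      = B.proj ∘ f
      ; lift      = λ h → proj₁ (proj₂ reps (B.lift h))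
      ; proj-lift = λ h →
          trans (sym (sameN⇒proj≡ B (proj₂ (proj₂ reps (B.lift h))))) (B.proj-lift h)
      ; inN⇒near  = λ { (inj₁ refl) → near-refl ; (inj₂ e) → B.inN⇒near (inj₂ e) }
      ; near⇒inN  = map₁ (λ e → proj₁ reps _ _ (proj≡⇒sameN B (cong B.proj e))) ∘ B.near⇒inN
      }

    twinQuotient-injective : Injective _≡_ _≡_ (B.proj ∘ f)
    twinQuotient-injective e = proj₁ reps _ _ (proj≡⇒sameN B e)

  module _ {n} {G : Graph n} (B : BlowUp G) (proj-injective : Injective _≡_ _≡_ (BlowUp.proj B))
           {k} (index : X ↔ Fin (suc (suc (suc k)))) where
    open BlowUp B
    private module I = Inverse index

    indexColour : Vertex → Fin (suc (suc (suc k)))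
    indexColour (x i)   = I.to i
    indexColour (u i j) = I.to j
    indexColour (v i j) = I.to j

    IndexPalette : Vertex → Fin (suc (suc (suc k))) → Set
    IndexPalette h a = a ≡ indexColour h

    indexPalette : IsPalette B (indexColour ∘ proj) IndexPalette
    indexPalette = record
      { sound    = λ _ → refl
      ; complete = λ { {h} refl → lift h , proj-lift h , cong indexColour (proj-lift h) }
      }

    indexColour-separates : Edge h h′ → Separates IndexPalette h h′ ⊎ Separates IndexPalette h′ h
    indexColour-separates (xu {i} {j} i≢j)
      with <⇒∃-avoided (s≤s (s≤s (s≤s z≤n))) (I.to i ∷ I.to j ∷ [])
    ... | a , a∉ = inj₁ (a , (u i (I.from a) , inj₂ (inj₁ (xu i≢ℓ)) , sym (I.strictlyInverseˡ a)) ,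
                         [ a∉ (suc zero) ∘ sym , [ a∉ (suc zero) ∘ sym , a∉ zero ∘ sym ]′ ]′
                           ∘ nearColours-u IndexPalette)
      where i≢ℓ : i ≢ I.from a
            i≢ℓ e = a∉ zero (trans (cong I.to e) (I.strictlyInverseˡ a))
    indexColour-separates (vx {i} {j} i≢j)
      with <⇒∃-avoided (s≤s (s≤s z≤n)) (I.to j ∷ [])
    ... | a , a∉ = inj₂ (a , (u j (I.from a) , inj₂ (inj₁ (xu j≢ℓ)) , sym (I.strictlyInverseˡ a)) ,
                         [ a∉ zero ∘ sym , [ a∉ zero ∘ sym , a∉ zero ∘ sym ]′ ]′
                           ∘ nearColours-v IndexPalette)
      where j≢ℓ : j ≢ I.from a
            j≢ℓ e = a∉ zero (trans (cong I.to e) (I.strictlyInverseˡ a))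
    indexColour-separates (uv {i} {j} i≢j) =
      inj₁ (I.to i , (x i , inj₂ (inj₂ (xu i≢j)) , refl) ,
            [ i≢j′ , [ i≢j′ , i≢j′ ]′ ]′ ∘ nearColours-v IndexPalette)
      where i≢j′ : I.to i ≢ I.to j
            i≢j′ = i≢j ∘ Injection.injective (↔⇒↣ index)

    χ-rlid-twinFree : ChiRlid≡ G (suc (suc (suc k)))
    χ-rlid-twinFree =
      (indexColour ∘ proj , isRlid-if-separated B indexPalette indexColour-separates) ,
      λ _ → rlid-lowerBound B I.from (Injection.injective (↔⇒↣ (↔-sym index)))
              (λ _ _ e → proj-injective (trans e (sym (proj-lift _))))

module Construction (r : ℕ) where

  q p t N : ℕ
  q = suc (suc (suc r))
  p = suc q
  t = choose2 q
  N = p + t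

  X : Set
  X = Fin p ⊎ Fin t

  open ArcSubdivision {X} (⊎-≡-dec _≟_ _≟_)

  private variable
    h h′ : Vertex

  Node : Set
  Node = Vertex ⊎ Fin t

  -- inj₂ k is a second true twin of x (inj₂ k)
  nodeVertex : Node → Vertex
  nodeVertex (inj₁ h) = h
  nodeVertex (inj₂ k) = x (inj₂ k)

  first second : X → Fin p
  first  (inj₁ a) = a
  first  (inj₂ k) = inject₁ (proj₁ (sortedPair q k))
  second (inj₁ a) = a
  second (inj₂ k) = inject₁ (proj₂ (sortedPair q k))

  -- label i j is a colour of x j when j ∈ inj₁, and of x i otherwise, so that N[v i j]
  -- (resp. N[u i j]) shows only the colours of its x-neighbour.
  label : X → X → Fin p
  label i (inj₁ b) = b
  label i (inj₂ _) = first i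

  colour : Node → Fin p
  colour (inj₁ (x i))   = first i
  colour (inj₁ (u i j)) = label i j
  colour (inj₁ (v i j)) = label i j
  colour (inj₂ k)       = second (inj₂ k)

  Palette : Vertex → Fin p → Set
  Palette (x i)   a = a ≡ first i ⊎ a ≡ second i
  Palette (u i j) a = a ≡ label i j
  Palette (v i j) a = a ≡ label i j

  colour-inPalette : ∀ w → Palette (nodeVertex w) (colour w)
  colour-inPalette (inj₁ (x i))   = inj₁ refl
  colour-inPalette (inj₁ (u i j)) = refl
  colour-inPalette (inj₁ (v i j)) = refl
  colour-inPalette (inj₂ k)       = inj₂ refl

  palette-realised : ∀ {h a} → Palette h a → ∃[ w ] nodeVertex w ≡ h × colour w ≡ a
  palette-realised {x i}        (inj₁ refl) = inj₁ (x i) , refl , refl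
  palette-realised {x (inj₁ b)} (inj₂ refl) = inj₁ (x (inj₁ b)) , refl , refl
  palette-realised {x (inj₂ k)} (inj₂ refl) = inj₂ k , refl , refl
  palette-realised {u i j}      refl        = inj₁ (u i j) , refl , refl
  palette-realised {v i j}      refl        = inj₁ (v i j) , refl , refl

  first<second : ∀ k → first (inj₂ k) < second (inj₂ k)
  first<second k = subst₂ ℕ._<_ (sym (toℕ-inject₁ _)) (sym (toℕ-inject₁ _)) (sortedPair-< q k)

  xPalette? : ∀ i a → Dec (Palette (x i) a)
  xPalette? i a = a ≟ first i ⊎-dec a ≟ second i

  xPalette-⊇pair⇒≡ : ∀ {i k} → Palette (x i) (first (inj₂ k)) → Palette (x i) (second (inj₂ k)) →
                     i ≡ inj₂ k
  xPalette-⊇pair⇒≡ {inj₁ a} {k} ∈₁ ∈₂ =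
    ⊥-elim (<⇒≢ (first<second k) (trans ([ id , id ]′ ∈₁) (sym ([ id , id ]′ ∈₂))))
  xPalette-⊇pair⇒≡ {inj₂ k′} {k} ∈₁ ∈₂ with sorted-pair-⊆ (first<second k) (first<second k′) ∈₁ ∈₂
  ... | e₁ , e₂ =
    cong inj₂ (sym (sortedPair-injective q
      (cong₂ _,_ (inject₁-injective e₁) (inject₁-injective e₂))))

  xPalette-outside : ∀ {i k} → i ≢ inj₂ k → ∃[ a ] Palette (x (inj₂ k)) a × ¬ Palette (x i) a
  xPalette-outside {i} {k} i≢k with xPalette? i (first (inj₂ k)) | xPalette? i (second (inj₂ k))
  ... | no ∉₁  | _      = _ , inj₁ refl , ∉₁
  ... | yes _  | no ∉₂  = _ , inj₂ refl , ∉₂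
  ... | yes ∈₁ | yes ∈₂ = ⊥-elim (i≢k (xPalette-⊇pair⇒≡ ∈₁ ∈₂))

  xPalette-other : ∀ {i b} → i ≢ inj₁ b → ∃[ a ] Palette (x i) a × a ≢ b
  xPalette-other {inj₁ a}     i≢b = a , inj₁ refl , i≢b ∘ cong inj₁
  xPalette-other {inj₂ k} {b} _   with first (inj₂ k) ≟ b
  ... | no ≢b  = _ , inj₁ refl , ≢b
  ... | yes ≡b = _ , inj₂ refl , λ ≡b′ → <⇒≢ (first<second k) (trans ≡b (sym ≡b′))

  nearPalette-u : ∀ {i j a} → NearColours Palette (u i j) a → a ≡ label i j ⊎ Palette (x i) a
  nearPalette-u = [ inj₁ , [ inj₁ , inj₂ ]′ ]′ ∘ nearColours-u Palette

  nearPalette-v : ∀ {i j a} → NearColours Palette (v i j) a → a ≡ label i j ⊎ Palette (x j) a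
  nearPalette-v = [ inj₁ , [ inj₁ , inj₂ ]′ ]′ ∘ nearColours-v Palette

  -- This is where p ≥ 4 is needed: three colours have to be avoided.
  freshColour : ∀ (b : Fin p) i → ∃[ a ] a ≢ b × ¬ Palette (x i) a
  freshColour b i with <⇒∃-avoided (s≤s (s≤s (s≤s (s≤s z≤n)))) (b ∷ first i ∷ second i ∷ [])
  ... | a , a∉ = a , a∉ zero ∘ sym , [ a∉ (suc zero) ∘ sym , a∉ (suc (suc zero)) ∘ sym ]′

  colour-separates : Edge h h′ → Separates Palette h h′ ⊎ Separates Palette h′ h
  colour-separates (xu {i} {j} i≢j) with freshColour (label i j) i
  ... | a , a≢ , a∉ =
    inj₁ (a , (u i (inj₁ a) , inj₂ (inj₁ (xu i≢a)) , refl) , [ a≢ , a∉ ]′ ∘ nearPalette-u)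
    where i≢a : i ≢ inj₁ a
          i≢a e = a∉ (inj₁ (sym (cong first e)))
  colour-separates (vx {i} {j} i≢j) with freshColour (label i j) j
  ... | a , a≢ , a∉ =
    inj₂ (a , (u j (inj₁ a) , inj₂ (inj₁ (xu j≢a)) , refl) , [ a≢ , a∉ ]′ ∘ nearPalette-v)
    where j≢a : j ≢ inj₁ a
          j≢a e = a∉ (inj₁ (sym (cong first e)))
  colour-separates (uv {i} {inj₁ b} i≢j) with xPalette-other i≢j
  ... | a , a∈ , a≢b =
    inj₁ (a , (x i , inj₂ (inj₂ (xu i≢j)) , a∈) , [ a≢b , [ a≢b , a≢b ]′ ]′ ∘ nearPalette-v)
  colour-separates (uv {i} {inj₂ k} i≢j) with xPalette-outside i≢j
  ... | a , a∈ , a∉ =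
    inj₂ (a , (x (inj₂ k) , inj₂ (inj₁ (vx i≢j)) , a∈) , [ a∉ ∘ inj₁ , a∉ ]′ ∘ nearPalette-u)

  X↔ : Fin N ↔ X
  X↔ = +↔⊎

  n : ℕ
  n = (N + (N * N + N * N)) + t

  nodes : Fin n ↔ Node
  nodes = ↔-trans +↔⊎ (↔-trans +↔⊎ (X↔ ⊎-↔ ↔-trans +↔⊎ (X²↔ ⊎-↔ X²↔)) ⊎-↔ ↔-refl)
    where X²↔ : Fin (N * N) ↔ (X × X)
          X²↔ = ↔-trans *↔× (X↔ ×-↔ X↔)

  private module V = Inverse nodes

  G : Graph n
  G = blowUp (nodeVertex ∘ V.to)

  G-blowUp : BlowUp G
  G-blowUp = blowUp-isBlowUp _ (V.from ∘ inj₁) (λ h → cong nodeVertex (V.strictlyInverseˡ (inj₁ h)))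

  colourPalette : IsPalette G-blowUp (colour ∘ V.to) Palette
  colourPalette = record { sound = colour-inPalette ∘ V.to ; complete = complete }
    where
    complete : ∀ {h a} → Palette h a → ∃[ z ] nodeVertex (V.to z) ≡ h × colour (V.to z) ≡ a
    complete a∈ with palette-realised a∈
    ... | w , refl , refl =
      V.from w , cong nodeVertex (V.strictlyInverseˡ w) , cong colour (V.strictlyInverseˡ w)

  singletonFibre : ∀ a z → nodeVertex (V.to z) ≡ x (inj₁ a) → z ≡ V.from (inj₁ (x (inj₁ a)))
  singletonFibre a z e = trans (sym (V.strictlyInverseʳ z)) (cong V.from (fibre (V.to z) e))
    where fibre : ∀ w → nodeVertex w ≡ x (inj₁ a) → w ≡ inj₁ (x (inj₁ a))
          fibre (inj₁ _) e = cong inj₁ e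

  χ-G : ChiRlid≡ G p
  χ-G = (colour ∘ V.to , isRlid-if-separated G-blowUp colourPalette colour-separates) ,
        λ _ → rlid-lowerBound G-blowUp inj₁ inj₁-injective singletonFibre

  χ-quotient : ∀ {m} {f : Fin m → Fin n} → IsTwinRepresentatives G f → ChiRlid≡ (induced G f) N
  χ-quotient reps =
    χ-rlid-twinFree (twinQuotient G-blowUp reps) (twinQuotient-injective G-blowUp reps) (↔-sym X↔)

  p≡N∸C : p ≡ N ∸ (q C 2)
  p≡N∸C = trans (sym (m+n∸n≡m p t)) (cong (N ∸_) (choose2≡C q))

mainTheorem6 : (p : ℕ) → 4 ≤ p →
    ∃[ n ] Σ (Graph n) λ G →
      ChiRlid≡ G p ×
      (∀ (m : ℕ) (f : Fin m → Fin n) → IsTwinRepresentatives G f →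
        ∃[ q ] (ChiRlid≡ (induced G f) q × p ≡ q ∸ ((p ∸ 1) C 2)))
mainTheorem6 (suc (suc (suc (suc r)))) (s≤s (s≤s (s≤s (s≤s _)))) =
  n , G , χ-G , λ _ _ reps → N , χ-quotient reps , p≡N∸C
  where open Construction r
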